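{- Let $k$ and $\lambda$ be odd positive integers, and let $\mathcal F$ be a $k$-MOFS$(2\lambda)$ that satisfies a full relation. Then $\mathcal F$ is maximal, i.e. there is no binary frequency square of order $2\lambda$ orthogonal to every member of $\mathcal F$.
   Context: Let $N(n)=\{1,\dots,n\}$ and let $n$ be even. A (binary) frequency square of order $n$ is an $n\times n$ array indexed by $N(n)\times N(n)$ with entries in $\{0,1\}$ such that every row and every column contains exactly $n/2$ zeros and $n/2$ ones. Two frequency squares $F,G$ of order $n$ are orthogonal if for each $(a,b)\in\{0,1\}^2$ the number of cells $(r,c)$ with $(F[r,c],G[r,c])=(a,b)$ equals $n^2/4$. A $k$-MOFS$(n)$ is an ordered set $F_1,\dots,F_k$ of pairwise orthogonal frequency squares of order $n$. Relations: form the $n^2\times(k+2)$ array $\mathcal O$ having a row $(i,j,F_1[i,j],\dots,F_k[i,j])$ for each $(i,j)\in N(n)^2$. Let $Y_1=Y_2=N(n)$ and $Y_c=\{0,1\}$ for $3\le c\le k+2$. A relation is a tuple $(X_1,\dots,X_{k+2})$ with $X_c\subseteq Y_c$ for all $c$ such that every row of $\mathcal O$ has an even number of positions $c$ for which the $c$-th entry of the row lies in $X_c$. A relation is trivial on column $c$ if $X_c=\emptyset$ or $X_c=Y_c$; it is full if it is non-trivial on every column $c\in\{1,\dots,k+2\}$ except possibly one of the columns $1,2$. -}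

module Defs where

open import Data.Nat using (ℕ; zero; suc; _+_; _*_)
open import Data.Nat.Divisibility using (_∣_)
open import Data.Bool using (Bool; true; false; if_then_else_; not; _∧_)
open import Data.Bool.Properties using () renaming (_≟_ to _≟B_)
open import Data.Fin using (Fin; zero; suc)
open import Data.Product using (_×_; Σ; _,_)
open import Data.Sum using (_⊎_)
open import Relation.Nullary using (¬_)
open import Relation.Nullary.Decidable using (⌊_⌋)
open import Relation.Binary.PropositionalEquality using (_≡_; _≢_)

sumFin : ∀ {m} → (Fin m → ℕ) → ℕ
sumFin {zero}  f = 0
sumFin {suc m} f = f zero + sumFin (λ x → f (suc x))

count : ∀ {m} → (Fin m → Bool) → ℕ
count p = sumFin (λ x → if p x then 1 else 0)

-- Binary arrays of order n, indexed by N(n) × N(n) (here Fin n × Fin n),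
-- entries in {0,1} encoded as Bool (false = 0, true = 1).
Square : ℕ → Set
Square n = Fin n → Fin n → Bool

IsFreqSquare : (h : ℕ) → Square (2 * h) → Set
IsFreqSquare h F =
  (∀ r → count (λ c → not (F r c)) ≡ h × count (λ c → F r c) ≡ h) ×
  (∀ c → count (λ r → not (F r c)) ≡ h × count (λ r → F r c) ≡ h)

pairCount : ∀ {n} → Square n → Square n → Bool → Bool → ℕ
pairCount F G a b =
  sumFin (λ r → count (λ c → ⌊ F r c ≟B a ⌋ ∧ ⌊ G r c ≟B b ⌋))

Orthogonal : (h : ℕ) → Square (2 * h) → Square (2 * h) → Set
Orthogonal h F G = ∀ a b → pairCount F G a b ≡ h * h

IsMOFS : (k h : ℕ) → (Fin k → Square (2 * h)) → Set
IsMOFS k h F = (∀ i → IsFreqSquare h (F i)) ×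
               (∀ i j → i ≢ j → Orthogonal h (F i) (F j))

-- Subsets are represented by their characteristic functions.
-- A subset X of a finite type A is trivial if X = ∅ or X = A.
Trivial : {A : Set} → (A → Bool) → Set
Trivial X = (∀ x → X x ≡ false) ⊎ (∀ x → X x ≡ true)

-- A relation (X_1, X_2, X_3, ..., X_{k+2}) on the orthogonal array of F:
-- X1, X2 ⊆ N(n) (columns 1 and 2), and XF i ⊆ {0,1} is the set X_{i+3}
-- for the column of the square F i.
record Relation (k n : ℕ) : Set where
  constructor rel
  field
    X1 : Fin n → Bool
    X2 : Fin n → Bool
    XF : Fin k → Bool → Bool

-- Number of positions c of row (r, c', F_1[r,c'], ..., F_k[r,c']) of the
-- orthogonal array whose entry lies in X_c.
hits : ∀ {k n} → (Fin k → Square n) → Relation k n → Fin n → Fin n → ℕ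
hits F R r c =
  (if Relation.X1 R r then 1 else 0) + (if Relation.X2 R c then 1 else 0) +
  count (λ i → Relation.XF R i (F i r c))

Satisfies : ∀ {k n} → (Fin k → Square n) → Relation k n → Set
Satisfies F R = ∀ r c → 2 ∣ hits F R r c

Full : ∀ {k n} → Relation k n → Set
Full R = (∀ i → ¬ Trivial (Relation.XF R i)) ×
         (¬ Trivial (Relation.X1 R) ⊎ ¬ Trivial (Relation.X2 R))

Maximal : (k h : ℕ) → (Fin k → Square (2 * h)) → Set
Maximal k h F =
  ¬ (Σ (Square (2 * h)) λ G → IsFreqSquare h G × (∀ i → Orthogonal h (F i) G))

{-# OPTIONS --safe #-}
module Submission where

-- Since each X_{i+3} is {0} or {1}, the square r,c ↦ [F_i(r,c) ∈ X_{i+3}] is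
-- F_i or its complement: again a frequency square, orthogonal to every square
-- orthogonal to F_i. Summing the relation along a row shows that |X_2| + kλ
-- is even, so |X_2| is odd; along a column, |X_1| is odd. If G were a
-- frequency square orthogonal to every F_i, summing the relation over the
-- cells where G = 1 would make λ|X_1| + λ|X_2| + kλ² even, although it is
-- the sum of three odd numbers.

open import Defs
open import Data.Bool using (Bool; true; false; not; _∧_; if_then_else_)
open import Data.Bool.Properties using (not-involutive) renaming (_≟_ to _≟B_)
open import Data.Fin using (Fin; zero; suc)
open import Data.Nat using (ℕ; zero; suc; _+_; _*_; parity)
open import Data.Nat.Divisibility
  using (_∣_; divides; _∣0; ∣-refl; ∣m∣n⇒∣m+n; ∣m+n∣m⇒∣n; ∣m⇒∣m*n; m∣m*n)
open import Data.Nat.Properties using (+-assoc; +-comm; *-comm; *-distribʳ-+; +-*-semiring)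
open import Algebra.Properties.Semiring.Sum +-*-semiring
  using (sum; ∑-distrib-+; ∑-comm; *-distribˡ-sum)
open import Data.Parity.Base as ℙ using (0ℙ; 1ℙ)
open import Data.Parity.Properties using (+-homo-+; *-homo-*; *-zeroʳ)
open import Data.Product using (_,_; proj₁; proj₂)
open import Data.Sum using (_⊎_; inj₁; inj₂)
open import Function using (flip)
open import Relation.Nullary using (¬_; contradiction)
open import Relation.Nullary.Decidable using (⌊_⌋)
open import Relation.Binary.PropositionalEquality
  using (_≡_; refl; sym; trans; cong; cong₂; subst; module ≡-Reasoning)

[_] : Bool → ℕ
[ b ] = if b then 1 else 0

sumFin≡sum : ∀ {m} (f : Fin m → ℕ) → sumFin f ≡ sum f
sumFin≡sum {zero}  f = refl
sumFin≡sum {suc m} f = cong (f zero +_) (sumFin≡sum (λ x → f (suc x)))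

sumFin-cong : ∀ {m} {f g : Fin m → ℕ} → (∀ x → f x ≡ g x) → sumFin f ≡ sumFin g
sumFin-cong {zero}  f≗g = refl
sumFin-cong {suc m} f≗g = cong₂ _+_ (f≗g zero) (sumFin-cong (λ x → f≗g (suc x)))

sumFin-const : ∀ m a → sumFin {m} (λ _ → a) ≡ m * a
sumFin-const zero    a = refl
sumFin-const (suc m) a = cong (a +_) (sumFin-const m a)

sumFin-+ : ∀ {m} (f g : Fin m → ℕ) → sumFin (λ x → f x + g x) ≡ sumFin f + sumFin g
sumFin-+ f g = begin
  sumFin (λ x → f x + g x)  ≡⟨ sumFin≡sum (λ x → f x + g x) ⟩
  sum (λ x → f x + g x)     ≡⟨ ∑-distrib-+ f g ⟩
  sum f + sum g             ≡⟨ sym (cong₂ _+_ (sumFin≡sum f) (sumFin≡sum g)) ⟩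
  sumFin f + sumFin g       ∎
  where open ≡-Reasoning

sumFin-*ˡ : ∀ {m} a (f : Fin m → ℕ) → sumFin (λ x → a * f x) ≡ a * sumFin f
sumFin-*ˡ a f = begin
  sumFin (λ x → a * f x)  ≡⟨ sumFin≡sum (λ x → a * f x) ⟩
  sum (λ x → a * f x)     ≡⟨ sym (*-distribˡ-sum a f) ⟩
  a * sum f               ≡⟨ cong (a *_) (sym (sumFin≡sum f)) ⟩
  a * sumFin f            ∎
  where open ≡-Reasoning

sumFin-*ʳ : ∀ {m} a (f : Fin m → ℕ) → sumFin (λ x → f x * a) ≡ sumFin f * a
sumFin-*ʳ a f = begin
  sumFin (λ x → f x * a)  ≡⟨ sumFin-cong (λ x → *-comm (f x) a) ⟩
  sumFin (λ x → a * f x)  ≡⟨ sumFin-*ˡ a f ⟩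
  a * sumFin f            ≡⟨ *-comm a _ ⟩
  sumFin f * a            ∎
  where open ≡-Reasoning

sumFin-comm : ∀ {m p} (f : Fin m → Fin p → ℕ) →
  sumFin (λ x → sumFin (f x)) ≡ sumFin (λ y → sumFin (λ x → f x y))
sumFin-comm f = begin
  sumFin (λ x → sumFin (f x))          ≡⟨ sumFin-cong (λ x → sumFin≡sum (f x)) ⟩
  sumFin (λ x → sum (f x))             ≡⟨ sumFin≡sum (λ x → sum (f x)) ⟩
  sum (λ x → sum (f x))                ≡⟨ ∑-comm f ⟩
  sum (λ y → sum (λ x → f x y))        ≡⟨ sym (sumFin≡sum (λ y → sum (λ x → f x y))) ⟩
  sumFin (λ y → sum (λ x → f x y))     ≡⟨ sumFin-cong (λ y → sym (sumFin≡sum (λ x → f x y))) ⟩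
  sumFin (λ y → sumFin (λ x → f x y))  ∎
  where open ≡-Reasoning

sum₂ : ∀ {m p} → (Fin m → Fin p → ℕ) → ℕ
sum₂ f = sumFin (λ x → sumFin (f x))

sum₂-cong : ∀ {m p} {f g : Fin m → Fin p → ℕ} → (∀ x y → f x y ≡ g x y) → sum₂ f ≡ sum₂ g
sum₂-cong f≗g = sumFin-cong (λ x → sumFin-cong (f≗g x))

sum₂-+ : ∀ {m p} (f g : Fin m → Fin p → ℕ) →
  sum₂ (λ x y → f x y + g x y) ≡ sum₂ f + sum₂ g
sum₂-+ f g = trans (sumFin-cong (λ x → sumFin-+ (f x) (g x))) (sumFin-+ (λ x → sumFin (f x)) _)

sum₂-sumFin-comm : ∀ {m p q} (f : Fin m → Fin p → Fin q → ℕ) →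
  sum₂ (λ x y → sumFin (f x y)) ≡ sumFin (λ z → sum₂ (λ x y → f x y z))
sum₂-sumFin-comm f =
  trans (sumFin-cong (λ x → sumFin-comm (f x))) (sumFin-comm (λ x z → sumFin (λ y → f x y z)))

∣-sumFin : ∀ {d m} {f : Fin m → ℕ} → (∀ x → d ∣ f x) → d ∣ sumFin f
∣-sumFin {m = zero}  d∣f = _ ∣0
∣-sumFin {m = suc m} d∣f = ∣m∣n⇒∣m+n (d∣f zero) (∣-sumFin (λ x → d∣f (suc x)))

count-cong : ∀ {m} {p q : Fin m → Bool} → (∀ x → p x ≡ q x) → count p ≡ count q
count-cong p≗q = sumFin-cong (λ x → cong [_] (p≗q x))

2∣⇒parity≡0ℙ : ∀ {n} → 2 ∣ n → parity n ≡ 0ℙ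
2∣⇒parity≡0ℙ (divides q refl) = trans (*-homo-* q 2) (*-zeroʳ (parity q))

parity≡0ℙ⇒2∣ : ∀ n → parity n ≡ 0ℙ → 2 ∣ n
parity≡0ℙ⇒2∣ zero          _    = 2 ∣0
parity≡0ℙ⇒2∣ (suc zero)    ()
parity≡0ℙ⇒2∣ (suc (suc n)) even = ∣m∣n⇒∣m+n ∣-refl (parity≡0ℙ⇒2∣ n even)

∤2⇒parity≡1ℙ : ∀ {n} → ¬ 2 ∣ n → parity n ≡ 1ℙ
∤2⇒parity≡1ℙ {n} 2∤n with parity n in eq
... | 1ℙ = refl
... | 0ℙ = contradiction (parity≡0ℙ⇒2∣ n eq) 2∤n

parity-*-1ℙ : ∀ m n → parity m ≡ 1ℙ → parity n ≡ 1ℙ → parity (m * n) ≡ 1ℙ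
parity-*-1ℙ m n odd-m odd-n = trans (*-homo-* m n) (cong₂ ℙ._*_ odd-m odd-n)

odd-summand : ∀ {m n} → 2 ∣ m + n → parity n ≡ 1ℙ → parity m ≡ 1ℙ
odd-summand {m} {n} 2∣m+n odd-n with parity m in eq
... | 1ℙ = refl
... | 0ℙ = contradiction 0ℙ≡1ℙ λ ()
  where
  open ≡-Reasoning
  0ℙ≡1ℙ : 0ℙ ≡ 1ℙ
  0ℙ≡1ℙ = begin
    0ℙ                     ≡⟨ sym (2∣⇒parity≡0ℙ 2∣m+n) ⟩
    parity (m + n)         ≡⟨ +-homo-+ m n ⟩
    parity m ℙ.+ parity n  ≡⟨ cong₂ ℙ._+_ eq odd-n ⟩
    1ℙ                     ∎

odd+odd+odd-∤2 : ∀ a b c → parity a ≡ 1ℙ → parity b ≡ 1ℙ → parity c ≡ 1ℙ → ¬ 2 ∣ a + b + c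
odd+odd+odd-∤2 a b c odd-a odd-b odd-c 2∣a+b+c
  with () ← trans (sym (odd-summand {a + b} 2∣a+b+c odd-c))
                  (trans (+-homo-+ a b) (cong₂ ℙ._+_ odd-a odd-b))

nonTrivial⇒≗id⊎≗not : (X : Bool → Bool) → ¬ Trivial X →
  (∀ b → X b ≡ b) ⊎ (∀ b → X b ≡ not b)
nonTrivial⇒≗id⊎≗not X nonTrivial with X false in X₀ | X true in X₁
... | false | true  = inj₁ λ { false → X₀ ; true → X₁ }
... | true  | false = inj₂ λ { false → X₀ ; true → X₁ }
... | false | false = contradiction (inj₁ λ { false → X₀ ; true → X₁ }) nonTrivial
... | true  | true  = contradiction (inj₂ λ { false → X₀ ; true → X₁ }) nonTrivial

module _ {h : ℕ} where

  IsFreqSquare-resp-≗ : {F F′ : Square (2 * h)} → (∀ r c → F r c ≡ F′ r c) →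
    IsFreqSquare h F → IsFreqSquare h F′
  IsFreqSquare-resp-≗ F≗F′ (rows , cols) =
    (λ r → trans (count-cong λ c → cong not (sym (F≗F′ r c))) (proj₁ (rows r)) ,
           trans (count-cong λ c → sym (F≗F′ r c)) (proj₂ (rows r))) ,
    (λ c → trans (count-cong λ r → cong not (sym (F≗F′ r c))) (proj₁ (cols c)) ,
           trans (count-cong λ r → sym (F≗F′ r c)) (proj₂ (cols c)))

  IsFreqSquare-complement : {F : Square (2 * h)} →
    IsFreqSquare h F → IsFreqSquare h (λ r c → not (F r c))
  IsFreqSquare-complement {F} (rows , cols) =
    (λ r → trans (count-cong λ c → not-involutive (F r c)) (proj₂ (rows r)) , proj₁ (rows r)) ,
    (λ c → trans (count-cong λ r → not-involutive (F r c)) (proj₂ (cols c)) , proj₁ (cols c))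

  IsFreqSquare-∘ : (X : Bool → Bool) → ¬ Trivial X → (F : Square (2 * h)) →
    IsFreqSquare h F → IsFreqSquare h (λ r c → X (F r c))
  IsFreqSquare-∘ X nonTrivial F freq with nonTrivial⇒≗id⊎≗not X nonTrivial
  ... | inj₁ X≗id  = IsFreqSquare-resp-≗ (λ r c → sym (X≗id _)) freq
  ... | inj₂ X≗not = IsFreqSquare-resp-≗ (λ r c → sym (X≗not _)) (IsFreqSquare-complement freq)

  pairCount-resp-≗ˡ : {F F′ G : Square (2 * h)} → (∀ r c → F r c ≡ F′ r c) →
    ∀ a b → pairCount F G a b ≡ pairCount F′ G a b
  pairCount-resp-≗ˡ F≗F′ a b =
    sumFin-cong λ r → count-cong λ c → cong (λ x → ⌊ x ≟B a ⌋ ∧ _) (F≗F′ r c)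

  pairCount-complementˡ : (F G : Square (2 * h)) →
    ∀ a b → pairCount (λ r c → not (F r c)) G a b ≡ pairCount F G (not a) b
  pairCount-complementˡ F G a b =
    sumFin-cong λ r → count-cong λ c → cong (_∧ _) (not-≟ (F r c) a)
    where
    not-≟ : ∀ x a → ⌊ not x ≟B a ⌋ ≡ ⌊ x ≟B not a ⌋
    not-≟ false false = refl
    not-≟ false true  = refl
    not-≟ true  false = refl
    not-≟ true  true  = refl

  Orthogonal-∘ˡ : (X : Bool → Bool) → ¬ Trivial X → (F G : Square (2 * h)) →
    Orthogonal h F G → Orthogonal h (λ r c → X (F r c)) G
  Orthogonal-∘ˡ X nonTrivial F G F⊥G a b with nonTrivial⇒≗id⊎≗not X nonTrivial
  ... | inj₁ X≗id  = trans (pairCount-resp-≗ˡ (λ r c → X≗id _) a b) (F⊥G a b)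
  ... | inj₂ X≗not = trans (pairCount-resp-≗ˡ (λ r c → X≗not _) a b)
                       (trans (pairCount-complementˡ F G a b) (F⊥G (not a) b))

pairCount-true-true : ∀ {n} (F G : Square n) →
  pairCount F G true true ≡ sum₂ (λ r c → [ F r c ] * [ G r c ])
pairCount-true-true F G = sum₂-cong λ r c → ≟true-∧-≟true (F r c) (G r c)
  where
  ≟true-∧-≟true : ∀ x y → [ ⌊ x ≟B true ⌋ ∧ ⌊ y ≟B true ⌋ ] ≡ [ x ] * [ y ]
  ≟true-∧-≟true false y     = refl
  ≟true-∧-≟true true  false = refl
  ≟true-∧-≟true true  true  = refl

sum₂-weighted-by-rows : ∀ {m n L} (X : Fin m → Bool) (G : Fin m → Fin n → Bool) →
  (∀ r → count (G r) ≡ L) →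
  sum₂ (λ r c → [ X r ] * [ G r c ]) ≡ count X * L
sum₂-weighted-by-rows {L = L} X G rows = begin
  sum₂ (λ r c → [ X r ] * [ G r c ])    ≡⟨ sumFin-cong (λ r → sumFin-*ˡ [ X r ] (λ c → [ G r c ])) ⟩
  sumFin (λ r → [ X r ] * count (G r))  ≡⟨ sumFin-cong (λ r → cong ([ X r ] *_) (rows r)) ⟩
  sumFin (λ r → [ X r ] * L)            ≡⟨ sumFin-*ʳ L (λ r → [ X r ]) ⟩
  count X * L                           ∎
  where open ≡-Reasoning

transposeRel : ∀ {k n} → Relation k n → Relation k n
transposeRel R = rel (Relation.X2 R) (Relation.X1 R) (Relation.XF R)

Satisfies-transpose : ∀ {k n} (F : Fin k → Square n) (R : Relation k n) →
  Satisfies F R → Satisfies (λ i → flip (F i)) (transposeRel R)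
Satisfies-transpose F R sat r c =
  subst (2 ∣_) (cong (_+ count (λ i → XF i (F i c r))) (+-comm [ X1 c ] [ X2 r ])) (sat c r)
  where open Relation R

module _ {k n} (F : Fin k → Square n) (R : Relation k n) where
  open Relation R

  sum-hits-row : ∀ {L} r → (∀ i → count (λ c → XF i (F i r c)) ≡ L) →
    sumFin (hits F R r) ≡ n * [ X1 r ] + count X2 + k * L
  sum-hits-row {L} r rows = begin
    sumFin (λ c → [ X1 r ] + [ X2 c ] + count (λ i → XF i (F i r c)))
      ≡⟨ sumFin-+ (λ c → [ X1 r ] + [ X2 c ]) _ ⟩
    sumFin (λ c → [ X1 r ] + [ X2 c ]) + sumFin (λ c → count (λ i → XF i (F i r c)))
      ≡⟨ cong₂ _+_ (sumFin-+ (λ _ → [ X1 r ]) (λ c → [ X2 c ])) (sumFin-comm λ c i → [ XF i (F i r c) ]) ⟩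
    sumFin {n} (λ _ → [ X1 r ]) + count X2 + sumFin (λ i → count (λ c → XF i (F i r c)))
      ≡⟨ cong₂ _+_ (cong (_+ count X2) (sumFin-const n [ X1 r ])) (sumFin-cong rows) ⟩
    n * [ X1 r ] + count X2 + sumFin {k} (λ _ → L)
      ≡⟨ cong (n * [ X1 r ] + count X2 +_) (sumFin-const k L) ⟩
    n * [ X1 r ] + count X2 + k * L
      ∎
    where open ≡-Reasoning

  odd-count-X2 : ∀ {L} → 2 ∣ n → parity (k * L) ≡ 1ℙ → Satisfies F R →
    (r : Fin n) → (∀ i → count (λ c → XF i (F i r c)) ≡ L) → parity (count X2) ≡ 1ℙ
  odd-count-X2 {L} 2∣n odd-kL sat r rows = odd-summand {count X2} 2∣X2+kL odd-kL
    where
    2∣row : 2 ∣ n * [ X1 r ] + (count X2 + k * L)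
    2∣row = subst (2 ∣_) (trans (sum-hits-row r rows) (+-assoc (n * [ X1 r ]) (count X2) (k * L)))
                  (∣-sumFin (sat r))
    2∣X2+kL : 2 ∣ count X2 + k * L
    2∣X2+kL = ∣m+n∣m⇒∣n 2∣row (∣m⇒∣m*n [ X1 r ] 2∣n)

  sum-hits-weighted : ∀ {L M} (G : Square n) →
    (∀ r → count (G r) ≡ L) → (∀ c → count (λ r → G r c) ≡ L) →
    (∀ i → sum₂ (λ r c → [ XF i (F i r c) ] * [ G r c ]) ≡ M) →
    sum₂ (λ r c → hits F R r c * [ G r c ]) ≡ count X1 * L + count X2 * L + k * M
  sum-hits-weighted {L} {M} G rows cols pairs = begin
    sum₂ (λ r c → hits F R r c * [ G r c ])
      ≡⟨ sum₂-cong distrib ⟩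
    sum₂ (λ r c → X1-part r c + X2-part r c + XF-part r c)
      ≡⟨ sum₂-+ (λ r c → X1-part r c + X2-part r c) XF-part ⟩
    sum₂ (λ r c → X1-part r c + X2-part r c) + sum₂ XF-part
      ≡⟨ cong (_+ sum₂ XF-part) (sum₂-+ X1-part X2-part) ⟩
    sum₂ X1-part + sum₂ X2-part + sum₂ XF-part
      ≡⟨ cong₂ _+_ (cong₂ _+_ (sum₂-weighted-by-rows X1 G rows) sum-X2-part) sum-XF-part ⟩
    count X1 * L + count X2 * L + k * M
      ∎
    where
    open ≡-Reasoning
    X1-part X2-part XF-part : Fin n → Fin n → ℕ
    X1-part r c = [ X1 r ] * [ G r c ]
    X2-part r c = [ X2 c ] * [ G r c ]
    XF-part r c = sumFin (λ i → [ XF i (F i r c) ] * [ G r c ])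

    distrib : ∀ r c → hits F R r c * [ G r c ] ≡ X1-part r c + X2-part r c + XF-part r c
    distrib r c = trans (*-distribʳ-+ [ G r c ] ([ X1 r ] + [ X2 c ]) _)
      (cong₂ _+_ (*-distribʳ-+ [ G r c ] [ X1 r ] [ X2 c ])
                 (sym (sumFin-*ʳ [ G r c ] (λ i → [ XF i (F i r c) ]))))

    sum-X2-part : sum₂ X2-part ≡ count X2 * L
    sum-X2-part = trans (sumFin-comm X2-part) (sum₂-weighted-by-rows X2 (flip G) cols)

    sum-XF-part : sum₂ XF-part ≡ k * M
    sum-XF-part = trans (sum₂-sumFin-comm (λ r c i → [ XF i (F i r c) ] * [ G r c ]))
                        (trans (sumFin-cong pairs) (sumFin-const k M))

theorem2p3 : (k λ' : ℕ) → ¬ (2 ∣ k) → ¬ (2 ∣ λ') →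
    (F : Fin k → Square (2 * λ')) → IsMOFS k λ' F →
    (R : Relation k (2 * λ')) → Satisfies F R → Full R →
    Maximal k λ' F
theorem2p3 k zero _ 2∤L _ _ _ _ _ _ = 2∤L (2 ∣0)
theorem2p3 k L@(suc _) 2∤k 2∤L F (freq , _) R sat (nonTrivial , _) (G , (G-rows , G-cols) , F⊥G) =
  odd+odd+odd-∤2 (count X1 * L) (count X2 * L) (k * (L * L))
    (parity-*-1ℙ (count X1) L odd-X1 odd-L) (parity-*-1ℙ (count X2) L odd-X2 odd-L)
    (parity-*-1ℙ k (L * L) odd-k (parity-*-1ℙ L L odd-L odd-L)) 2∣weighted
  where
  open Relation R

  E : Fin k → Square (2 * L)
  E i r c = XF i (F i r c)

  E-freq : ∀ i → IsFreqSquare L (E i)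
  E-freq i = IsFreqSquare-∘ (XF i) (nonTrivial i) (F i) (freq i)

  odd-k : parity k ≡ 1ℙ
  odd-k = ∤2⇒parity≡1ℙ 2∤k

  odd-L : parity L ≡ 1ℙ
  odd-L = ∤2⇒parity≡1ℙ 2∤L

  odd-kL : parity (k * L) ≡ 1ℙ
  odd-kL = parity-*-1ℙ k L odd-k odd-L

  odd-X2 : parity (count X2) ≡ 1ℙ
  odd-X2 = odd-count-X2 F R (m∣m*n L) odd-kL sat zero (λ i → proj₂ (proj₁ (E-freq i) zero))

  odd-X1 : parity (count X1) ≡ 1ℙ
  odd-X1 = odd-count-X2 (λ i → flip (F i)) (transposeRel R) (m∣m*n L) odd-kL
             (Satisfies-transpose F R sat) zero (λ i → proj₂ (proj₂ (E-freq i) zero))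

  2∣weighted : 2 ∣ count X1 * L + count X2 * L + k * (L * L)
  2∣weighted = subst (2 ∣_)
    (sum-hits-weighted F R G (λ r → proj₂ (G-rows r)) (λ c → proj₂ (G-cols c)) λ i →
      trans (sym (pairCount-true-true (E i) G))
            (Orthogonal-∘ˡ (XF i) (nonTrivial i) (F i) G (F⊥G i) true true))
    (∣-sumFin λ r → ∣-sumFin λ c → ∣m⇒∣m*n [ G r c ] (sat r c))
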